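{- Let $\mathbf{L}$ be an intuitionistic modal logic containing, for all groups $\alpha,\beta$, the formulas - $[\alpha]p\vee[\beta]p\rightarrow[\alpha\cup\beta]p$, - $\langle\alpha\cup\beta\rangle p\rightarrow\langle\alpha\rangle p\wedge\langle\beta\rangle p$. Then the canonical frame $(W_{\mathbf{L}},\leq_{\mathbf{L}},R_{\mathbf{L}})$ of $\mathbf{L}$ is prestandard, i.e., $R_{\mathbf{L}}(\alpha\cup\beta)\subseteq R_{\mathbf{L}}(\alpha)\cap R_{\mathbf{L}}(\beta)$ for all groups $\alpha,\beta$.
   Context: **Language.** Let $\mathbf{At}$ be a countably infinite set of atoms and let $\mathbf{Ag}$ be a finite set of agents. A group is a nonempty subset of $\mathbf{Ag}$. Formulas are generated by $$A ::= p \mid (A\rightarrow A) \mid \top \mid \bot \mid (A\vee A) \mid (A\wedge A) \mid [\alpha]A \mid \langle\alpha\rangle A,$$ and $\neg A$ abbreviates $A\rightarrow\bot$. **Logics.** An intuitionistic modal logic is a set of formulas that satisfies all of the following: - it is closed under uniform substitution; - it contains the axioms of intuitionistic propositional logic; - for every group $\alpha$, it contains - $[\alpha]p\wedge[\alpha]q\rightarrow[\alpha](p\wedge q)$, - $\langle\alpha\rangle(p\vee q)\rightarrow\langle\alpha\rangle p\vee\langle\alpha\rangle q$, - $[\alpha]\top$, - $\neg\langle\alpha\rangle\bot$, - $[\alpha](p\vee q)\rightarrow((\langle\alpha\rangle p\rightarrow[\alpha]q)\rightarrow[\alpha]q)$; - it is closed under modus ponens; - for every group $\alpha$, it is closed under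 the rules - from $p\rightarrow q$ infer $[\alpha]p\rightarrow[\alpha]q$, - from $p\rightarrow q$ infer $\langle\alpha\rangle p\rightarrow\langle\alpha\rangle q$, - from $\langle\alpha\rangle p\rightarrow q\vee[\alpha](p\rightarrow r)$ infer $\langle\alpha\rangle p\rightarrow q\vee\langle\alpha\rangle r$. **Theories.** An $\mathbf{L}$-theory is a set of formulas containing $\mathbf{L}$ and closed under modus ponens. It is proper if it does not contain $\bot$. It is prime if it is proper and, whenever $A\vee B$ belongs to it, $A$ or $B$ belongs to it. **Canonical frame.** For a set $\Gamma$ of formulas, let $[\alpha]\Gamma=\{A:[\alpha]A\in\Gamma\}$ and $\langle\alpha\rangle\Gamma=\{\langle\alpha\rangle A:A\in\Gamma\}$. The canonical frame of $\mathbf{L}$ is $(W_{\mathbf{L}},\leq_{\mathbf{L}},R_{\mathbf{L}})$, where: - $W_{\mathbf{L}}$ is the set of all prime $\mathbf{L}$-theories; - $\Gamma\leq_{\mathbf{L}}\Delta$ iff $\Gamma\subseteq\Delta$; - $\Gamma R_{\mathbf{L}}(\alpha)\Delta$ iff $[\alpha]\Gamma\subseteq\Delta$ and $\langle\alpha\rangle\Delta\subseteq\Gamma$. -}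

module Defs where

open import Data.Nat using (ℕ)
open import Data.Fin using (Fin)
open import Data.Fin.Subset using (Subset; Nonempty; _∪_)
open import Data.Fin.Subset.Properties using (x∈p∪q⁺)
open import Data.Product using (Σ; _×_; _,_)
open import Data.Sum using (_⊎_; inj₁)
open import Data.Empty using (⊥)

Group : ℕ → Set
Group n = Σ (Subset n) Nonempty

_∪ᵍ_ : ∀ {n} → Group n → Group n → Group n
(a , (x , x∈a)) ∪ᵍ (b , _) = (a ∪ b) , (x , x∈p∪q⁺ (inj₁ x∈a))

infixr 5 _⇒_
infixr 6 _∨_
infixr 7 _∧_
data Form (n : ℕ) : Set where
  var  : ℕ → Form n
  _⇒_  : Form n → Form n → Form n
  ⊤'   : Form n
  ⊥'   : Form n
  _∨_  : Form n → Form n → Form n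
  _∧_  : Form n → Form n → Form n
  [_]_ : Group n → Form n → Form n
  ⟨_⟩_ : Group n → Form n → Form n

¬' : ∀ {n} → Form n → Form n
¬' A = A ⇒ ⊥'

p q r : ∀ {n} → Form n
p = var 0
q = var 1
r = var 2

sub : ∀ {n} → (ℕ → Form n) → Form n → Form n
sub σ (var i) = σ i
sub σ (A ⇒ B) = sub σ A ⇒ sub σ B
sub σ ⊤' = ⊤'
sub σ ⊥' = ⊥'
sub σ (A ∨ B) = sub σ A ∨ sub σ B
sub σ (A ∧ B) = sub σ A ∧ sub σ B
sub σ ([ α ] A) = [ α ] sub σ A
sub σ (⟨ α ⟩ A) = ⟨ α ⟩ sub σ A

FSet : ℕ → Set₁
FSet n = Form n → Set

data IPCAxiom {n : ℕ} : Form n → Set where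
  ax-K   : ∀ A B → IPCAxiom (A ⇒ (B ⇒ A))
  ax-S   : ∀ A B C → IPCAxiom ((A ⇒ (B ⇒ C)) ⇒ ((A ⇒ B) ⇒ (A ⇒ C)))
  ax-∧E₁ : ∀ A B → IPCAxiom (A ∧ B ⇒ A)
  ax-∧E₂ : ∀ A B → IPCAxiom (A ∧ B ⇒ B)
  ax-∧I  : ∀ A B → IPCAxiom (A ⇒ (B ⇒ A ∧ B))
  ax-∨I₁ : ∀ A B → IPCAxiom (A ⇒ A ∨ B)
  ax-∨I₂ : ∀ A B → IPCAxiom (B ⇒ A ∨ B)
  ax-∨E  : ∀ A B C → IPCAxiom ((A ⇒ C) ⇒ ((B ⇒ C) ⇒ (A ∨ B ⇒ C)))
  ax-⊥   : ∀ A → IPCAxiom (⊥' ⇒ A)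
  ax-⊤   : IPCAxiom ⊤'

ClosedMP : ∀ {n} → FSet n → Set
ClosedMP Γ = ∀ A B → Γ (A ⇒ B) → Γ A → Γ B

record IML {n : ℕ} (L : FSet n) : Set where
  field
    subst-closed : ∀ σ A → L A → L (sub σ A)
    ipc          : ∀ A → IPCAxiom A → L A
    ax1 : ∀ α → L ([ α ] p ∧ [ α ] q ⇒ [ α ] (p ∧ q))
    ax2 : ∀ α → L (⟨ α ⟩ (p ∨ q) ⇒ ⟨ α ⟩ p ∨ ⟨ α ⟩ q)
    ax3 : ∀ α → L ([ α ] ⊤')
    ax4 : ∀ α → L (¬' (⟨ α ⟩ ⊥'))
    ax5 : ∀ α → L ([ α ] (p ∨ q) ⇒ ((⟨ α ⟩ p ⇒ [ α ] q) ⇒ [ α ] q))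
    mp  : ClosedMP L
    rule-□ : ∀ α A B → L (A ⇒ B) → L ([ α ] A ⇒ [ α ] B)
    rule-◇ : ∀ α A B → L (A ⇒ B) → L (⟨ α ⟩ A ⇒ ⟨ α ⟩ B)
    rule-◇□ : ∀ α A B C → L (⟨ α ⟩ A ⇒ B ∨ [ α ] (A ⇒ C))
                        → L (⟨ α ⟩ A ⇒ B ∨ ⟨ α ⟩ C)

record Theory {n : ℕ} (L : FSet n) (Γ : FSet n) : Set where
  field
    contains-L : ∀ A → L A → Γ A
    closed-MP  : ClosedMP Γ

record Prime {n : ℕ} (L : FSet n) (Γ : FSet n) : Set where
  field
    theory : Theory L Γ
    proper : Γ ⊥' → ⊥
    prime  : ∀ A B → Γ (A ∨ B) → Γ A ⊎ Γ B

W : ∀ {n} → FSet n → Set₁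
W {n} L = Σ (FSet n) (Prime L)

_≤L_ : ∀ {n} {L : FSet n} → W L → W L → Set
(Γ , _) ≤L (Δ , _) = ∀ A → Γ A → Δ A

RL : ∀ {n} {L : FSet n} → Group n → W L → W L → Set
RL α (Γ , _) (Δ , _) =
  (∀ A → Γ ([ α ] A) → Δ A) × (∀ A → Δ A → Γ (⟨ α ⟩ A))

Prestandard : ∀ {n} (L : FSet n) → Set₁
Prestandard {n} L = ∀ (α β : Group n) (Γ Δ : W L) →
  RL (α ∪ᵍ β) Γ Δ → RL α Γ Δ × RL β Γ Δ

module Submission where

open import Defs
open import Data.Nat using (ℕ)
open import Data.Product using (_,_)
open import Function using (_∘_)

-- Inside any L-theory Γ the two axioms act as inclusions [α]Γ ⊆ [α ∪ β]Γ and
-- ⟨α ∪ β⟩-formulas ⊆ ⟨α⟩-formulas, which compose with the two halves of Γ R(α ∪ β) Δ.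

module TheoryReasoning {n : ℕ} {L : FSet n} (iml : IML L) {Γ : FSet n} (thy : Theory L Γ) where
  open IML iml using (subst-closed; ipc)
  open Theory thy using (contains-L; closed-MP)

  theory-mp-L : ∀ {A B} → L (A ⇒ B) → Γ A → Γ B
  theory-mp-L ⊢A⇒B = closed-MP _ _ (contains-L _ ⊢A⇒B)

  theory-mp-instance : ∀ {A B} C → L (A ⇒ B) → Γ (sub (λ _ → C) A) → Γ (sub (λ _ → C) B)
  theory-mp-instance C = theory-mp-L ∘ subst-closed (λ _ → C) _

  theory-∨-introˡ : ∀ {A B} → Γ A → Γ (A ∨ B)
  theory-∨-introˡ = theory-mp-L (ipc _ (ax-∨I₁ _ _))

  theory-∨-introʳ : ∀ {A B} → Γ B → Γ (A ∨ B)
  theory-∨-introʳ = theory-mp-L (ipc _ (ax-∨I₂ _ _))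

  theory-∧-elimˡ : ∀ {A B} → Γ (A ∧ B) → Γ A
  theory-∧-elimˡ = theory-mp-L (ipc _ (ax-∧E₁ _ _))

  theory-∧-elimʳ : ∀ {A B} → Γ (A ∧ B) → Γ B
  theory-∧-elimʳ = theory-mp-L (ipc _ (ax-∧E₂ _ _))

open TheoryReasoning

module UnionAxioms {n : ℕ} {L : FSet n} (iml : IML L) (α β : Group n)
         (box-union : L ([ α ] p ∨ [ β ] p ⇒ [ α ∪ᵍ β ] p))
         (dia-union : L (⟨ α ∪ᵍ β ⟩ p ⇒ ⟨ α ⟩ p ∧ ⟨ β ⟩ p))
         {Γ : FSet n} (thy : Theory L Γ) where

  box-union-introˡ : ∀ A → Γ ([ α ] A) → Γ ([ α ∪ᵍ β ] A)
  box-union-introˡ A = theory-mp-instance iml thy A box-union ∘ theory-∨-introˡ iml thy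

  box-union-introʳ : ∀ A → Γ ([ β ] A) → Γ ([ α ∪ᵍ β ] A)
  box-union-introʳ A = theory-mp-instance iml thy A box-union ∘ theory-∨-introʳ iml thy

  dia-union-elimˡ : ∀ A → Γ (⟨ α ∪ᵍ β ⟩ A) → Γ (⟨ α ⟩ A)
  dia-union-elimˡ A = theory-∧-elimˡ iml thy ∘ theory-mp-instance iml thy A dia-union

  dia-union-elimʳ : ∀ A → Γ (⟨ α ∪ᵍ β ⟩ A) → Γ (⟨ β ⟩ A)
  dia-union-elimʳ A = theory-∧-elimʳ iml thy ∘ theory-mp-instance iml thy A dia-union

proposition25 : ∀ (n : ℕ) (L : FSet n) → IML L
    → (∀ (α β : Group n) → L ([ α ] p ∨ [ β ] p ⇒ [ α ∪ᵍ β ] p))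
    → (∀ (α β : Group n) → L (⟨ α ∪ᵍ β ⟩ p ⇒ ⟨ α ⟩ p ∧ ⟨ β ⟩ p))
    → Prestandard L
proposition25 n L iml box-union dia-union α β (Γ , Γ-prime) _ (box⊆ , dia⊇) =
  ((λ A → box⊆ A ∘ box-union-introˡ A) , (λ A → dia-union-elimˡ A ∘ dia⊇ A))
  , ((λ A → box⊆ A ∘ box-union-introʳ A) , (λ A → dia-union-elimʳ A ∘ dia⊇ A))
  where
  open UnionAxioms iml α β (box-union α β) (dia-union α β) (Prime.theory Γ-prime)
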